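{- Let $\mathcal{G}$ be a graph class containing all complete graphs and let $k\ge 0$. Then $R_k^{\mathcal{G}}(i,k+2)=i$ for all $i\ge k+2$.
   Context: All graphs are finite and simple. For a graph $G$ and an integer $k\ge 0$, a set $S\subseteq V(G)$ is $k$-sparse if every vertex of $S$ has at most $k$ neighbours in $S$, and $k$-dense if every vertex of $S$ is non-adjacent to at most $k$ other vertices of $S$. A $k$-sparse (resp. $k$-dense) $j$-set is a $k$-sparse (resp. $k$-dense) set of exactly $j$ vertices. For a graph class $\mathcal{G}$, $R_k^{\mathcal{G}}(i,j)$ is the smallest $n$ such that every graph in $\mathcal{G}$ on $n$ vertices has a $k$-dense $i$-set or a $k$-sparse $j$-set. -}

module Defs where

open import Data.Nat using (ℕ; _≤_; _<_)
open import Data.Bool using (Bool; true; false; _∧_; not)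
open import Data.Fin using (Fin; _≟_)
open import Data.Fin.Subset using (Subset; _∈_; ∣_∣)
open import Data.Vec using (lookup)
open import Data.List using (List; length; filterᵇ; allFin)
open import Data.Product using (Σ; _×_)
open import Data.Sum using (_⊎_)
open import Relation.Nullary using (¬_; ⌊_⌋)
open import Relation.Binary.PropositionalEquality using (_≡_)

record Graph (n : ℕ) : Set where
  field
    adj    : Fin n → Fin n → Bool
    adj-sym    : ∀ u v → adj u v ≡ adj v u
    adj-irrefl : ∀ v → adj v v ≡ false
open Graph public

complete : (n : ℕ) → Graph n
complete n = record
  { adj    = λ u v → not ⌊ u ≟ v ⌋
  ; adj-sym    = symK
  ; adj-irrefl = irrK
  }
  where
  open import Relation.Binary.PropositionalEquality using (refl; sym)
  open import Relation.Nullary using (yes; no)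
  symK : ∀ (u v : Fin n) → not ⌊ u ≟ v ⌋ ≡ not ⌊ v ≟ u ⌋
  symK u v with u ≟ v | v ≟ u
  ... | yes _ | yes _ = refl
  ... | no _  | no _  = refl
  ... | yes p | no q  with q (sym p)
  ... | ()
  symK u v | no q | yes p with q (sym p)
  ... | ()
  irrK : ∀ (v : Fin n) → not ⌊ v ≟ v ⌋ ≡ false
  irrK v with v ≟ v
  ... | yes _ = refl
  ... | no q with q refl
  ... | ()

nbrsIn : ∀ {n} → Graph n → Subset n → Fin n → ℕ
nbrsIn G S u = length (filterᵇ (λ v → lookup S v ∧ adj G u v) (allFin _))

nonNbrsIn : ∀ {n} → Graph n → Subset n → Fin n → ℕ
nonNbrsIn G S u =
  length (filterᵇ (λ v → lookup S v ∧ (not ⌊ u ≟ v ⌋ ∧ not (adj G u v))) (allFin _))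

kSparse : ∀ {n} → ℕ → Graph n → Subset n → Set
kSparse k G S = ∀ u → u ∈ S → nbrsIn G S u ≤ k

kDense : ∀ {n} → ℕ → Graph n → Subset n → Set
kDense k G S = ∀ u → u ∈ S → nonNbrsIn G S u ≤ k

HasDenseSet : ∀ {n} → ℕ → Graph n → ℕ → Set
HasDenseSet k G i = Σ (Subset _) λ S → ∣ S ∣ ≡ i × kDense k G S

HasSparseSet : ∀ {n} → ℕ → Graph n → ℕ → Set
HasSparseSet k G j = Σ (Subset _) λ S → ∣ S ∣ ≡ j × kSparse k G S

GraphClass : Set₁
GraphClass = (n : ℕ) → Graph n → Set

ContainsCompleteGraphs : GraphClass → Set
ContainsCompleteGraphs 𝒢 = ∀ n → 𝒢 n (complete n)

RamseyProp : GraphClass → ℕ → ℕ → ℕ → ℕ → Set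
RamseyProp 𝒢 k i j n = ∀ (G : Graph n) → 𝒢 n G → HasDenseSet k G i ⊎ HasSparseSet k G j

RamseyNumberIs : GraphClass → ℕ → ℕ → ℕ → ℕ → Set
RamseyNumberIs 𝒢 k i j n = RamseyProp 𝒢 k i j n × (∀ m → m < n → ¬ RamseyProp 𝒢 k i j m)

-- Every graph G on n vertices is either k-dense as a whole, or has a vertex u
-- with at least k + 1 non-neighbours; u together with k + 1 of them is a
-- k-sparse (k + 2)-set, since u has no neighbour in it and every other vertex
-- can only be adjacent to the remaining k.  Conversely, in the complete graph
-- K_m with m < i there is no i-set at all, and in any (k + 2)-set every vertex
-- has k + 1 neighbours.
module Submission where

open import Defs
open import Data.Nat using (ℕ; zero; suc; _≤_; _<_; _+_; z≤n; s≤s; _≤?_)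
open import Data.Nat.Properties
  using (≤-trans; ≤-reflexive; ≤-pred; <⇒≱; ≰⇒>; +-comm; 1+n≰n; module ≤-Reasoning)
open import Data.Bool using (Bool; true; false; _∧_; not)
open import Data.Bool.Properties using (not-¬)
open import Data.Fin using (Fin; zero; suc; _≟_)
open import Data.Fin.Properties using (all?; ¬∀⟶∃¬)
open import Data.Fin.Subset
  using (Subset; inside; outside; _∈_; _∉_; _⊆_; ∣_∣; ⊤; ⊥; ⁅_⁆; _∪_; _∩_; _-_; Nonempty; Empty)
open import Data.Fin.Subset.Properties
  using ( ∣p∣≤n; ∣⊤∣≡n; ∣⊥∣≡0; p⊆q⇒∣p∣≤∣q∣; ⊆-min; s⊆s; ∪-identityˡ; Empty-unique; nonempty?
        ; x∈⁅x⁆; x∈⁅y⁆⇒x≡y; x∈p∪q⁺; x∈p∪q⁻; x∈p∩q⁺; x∈p∩q⁻; p∩q⊆q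
        ; x∈p∧x≢y⇒x∈p-y; x∈p⇒∣p-x∣<∣p∣ )
open import Data.Vec using (_∷_; []; here; there; lookup; tabulate)
open import Data.Vec.Properties using (lookup∘tabulate; []=⇒lookup; lookup⇒[]=)
import Data.List as List
open import Data.List using (length; filterᵇ; allFin)
open import Data.Product using (∃; _×_; _,_; proj₁; proj₂)
open import Data.Sum using (_⊎_; inj₁; inj₂)
open import Function using (_∘_; id)
open import Relation.Nullary using (¬_; yes; no; ⌊_⌋; contradiction)
open import Relation.Binary.PropositionalEquality

private
  variable
    A : Set
    n : ℕ
    x : Fin n
    p : Subset n

∈-tabulate⁺ : {f : Fin n → Bool} → f x ≡ true → x ∈ tabulate f
∈-tabulate⁺ {x = x} {f = f} fx = lookup⇒[]= x (tabulate f) (trans (lookup∘tabulate f x) fx)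

∈-tabulate⁻ : {f : Fin n → Bool} → x ∈ tabulate f → f x ≡ true
∈-tabulate⁻ {x = x} {f = f} x∈ = trans (sym (lookup∘tabulate f x)) ([]=⇒lookup x∈)

tabulate-∧ : (p : Subset n) (f : Fin n → Bool) → tabulate (λ v → lookup p v ∧ f v) ≡ p ∩ tabulate f
tabulate-∧ []      f = refl
tabulate-∧ (s ∷ p) f = cong (s ∧ f zero ∷_) (tabulate-∧ p (f ∘ suc))

length-filterᵇ-tabulate : (f : A → Bool) (g : Fin n → A) →
                          length (filterᵇ f (List.tabulate g)) ≡ ∣ tabulate (f ∘ g) ∣
length-filterᵇ-tabulate {n = zero}  f g = refl
length-filterᵇ-tabulate {n = suc n} f g with f (g zero)
... | true  = cong suc (length-filterᵇ-tabulate f (g ∘ suc))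
... | false = length-filterᵇ-tabulate f (g ∘ suc)

length-filterᵇ-allFin : (f : Fin n → Bool) → length (filterᵇ f (allFin n)) ≡ ∣ tabulate f ∣
length-filterᵇ-allFin f = length-filterᵇ-tabulate f id

x∉p⇒∣⁅x⁆∪p∣≡1+∣p∣ : x ∉ p → ∣ ⁅ x ⁆ ∪ p ∣ ≡ suc ∣ p ∣
x∉p⇒∣⁅x⁆∪p∣≡1+∣p∣ {x = zero}  {p = outside ∷ p} _   = cong (suc ∘ ∣_∣) (∪-identityˡ p)
x∉p⇒∣⁅x⁆∪p∣≡1+∣p∣ {x = zero}  {p = inside ∷ p}  x∉p = contradiction here x∉p
x∉p⇒∣⁅x⁆∪p∣≡1+∣p∣ {x = suc x} {p = outside ∷ p} x∉p = x∉p⇒∣⁅x⁆∪p∣≡1+∣p∣ (x∉p ∘ there)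
x∉p⇒∣⁅x⁆∪p∣≡1+∣p∣ {x = suc x} {p = inside ∷ p}  x∉p = cong suc (x∉p⇒∣⁅x⁆∪p∣≡1+∣p∣ (x∉p ∘ there))

Empty⇒∣p∣≡0 : {p : Subset n} → Empty p → ∣ p ∣ ≡ 0
Empty⇒∣p∣≡0 {n = n} empty = trans (cong ∣_∣ (Empty-unique empty)) (∣⊥∣≡0 n)

0<∣p∣⇒Nonempty : 0 < ∣ p ∣ → Nonempty p
0<∣p∣⇒Nonempty {p = p} 0<∣p∣ with nonempty? p
... | yes nonempty = nonempty
... | no  empty    = contradiction (Empty⇒∣p∣≡0 empty) λ ∣p∣≡0 → <⇒≱ 0<∣p∣ (≤-reflexive ∣p∣≡0)

⊆-withSize : {n : ℕ} (k : ℕ) (p : Subset n) → k ≤ ∣ p ∣ → ∃ λ q → q ⊆ p × ∣ q ∣ ≡ k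
⊆-withSize {n} zero p _ = ⊥ , ⊆-min p , ∣⊥∣≡0 n
⊆-withSize (suc k) (inside ∷ p) (s≤s k≤∣p∣) with ⊆-withSize k p k≤∣p∣
... | q , q⊆p , ∣q∣≡k = inside ∷ q , s⊆s q⊆p , cong suc ∣q∣≡k
⊆-withSize (suc k) (outside ∷ p) k<∣p∣ with ⊆-withSize (suc k) p k<∣p∣
... | q , q⊆p , ∣q∣≡k = outside ∷ q , s⊆s q⊆p , ∣q∣≡k

neighbours : Graph n → Fin n → Subset n
neighbours G u = tabulate (adj G u)

nonNeighbours : Graph n → Fin n → Subset n
nonNeighbours G u = tabulate (λ v → not ⌊ u ≟ v ⌋ ∧ not (adj G u v))

module _ (G : Graph n) (S : Subset n) (u : Fin n) where

  nbrsIn≡∣∩neighbours∣ : nbrsIn G S u ≡ ∣ S ∩ neighbours G u ∣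
  nbrsIn≡∣∩neighbours∣ =
    trans (length-filterᵇ-allFin (λ v → lookup S v ∧ adj G u v))
          (cong ∣_∣ (tabulate-∧ S (adj G u)))

  nonNbrsIn≡∣∩nonNeighbours∣ : nonNbrsIn G S u ≡ ∣ S ∩ nonNeighbours G u ∣
  nonNbrsIn≡∣∩nonNeighbours∣ =
    trans (length-filterᵇ-allFin (λ v → lookup S v ∧ (not ⌊ u ≟ v ⌋ ∧ not (adj G u v))))
          (cong ∣_∣ (tabulate-∧ S _))

∈-nonNeighbours⁻ : (G : Graph n) {u v : Fin n} → v ∈ nonNeighbours G u → u ≢ v × adj G u v ≡ false
∈-nonNeighbours⁻ G {u} {v} v∈ with u ≟ v | adj G u v | ∈-tabulate⁻ v∈
... | no u≢v | false | _  = u≢v , refl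
... | no _   | true  | ()
... | yes _  | _     | ()

∈-neighbours-complete⁺ : {u v : Fin n} → u ≢ v → v ∈ neighbours (complete n) u
∈-neighbours-complete⁺ {u = u} {v} u≢v = ∈-tabulate⁺ (not-isYes u≢v)
  where
  not-isYes : u ≢ v → not ⌊ u ≟ v ⌋ ≡ true
  not-isYes u≢v with u ≟ v
  ... | yes u≡v = contradiction u≡v u≢v
  ... | no  _   = refl

module Star (G : Graph n) {u : Fin n} {T : Subset n} (T⊆nonNbrs : T ⊆ nonNeighbours G u) where

  nonAdjacent : {v : Fin n} → v ∈ T → adj G u v ≡ false
  nonAdjacent v∈T = proj₂ (∈-nonNeighbours⁻ G (T⊆nonNbrs v∈T))

  u∉T : u ∉ T
  u∉T u∈T = proj₁ (∈-nonNeighbours⁻ G (T⊆nonNbrs u∈T)) refl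

  centre-isolated : Empty ((⁅ u ⁆ ∪ T) ∩ neighbours G u)
  centre-isolated (v , v∈) with x∈p∩q⁻ (⁅ u ⁆ ∪ T) _ v∈
  ... | v∈star , v∈nbrs with x∈p∪q⁻ ⁅ u ⁆ T v∈star
  ...   | inj₁ v∈⁅u⁆ =
    not-¬ (subst (λ v → adj G u v ≡ true) (x∈⁅y⁆⇒x≡y u v∈⁅u⁆) (∈-tabulate⁻ v∈nbrs)) (adj-irrefl G u)
  ...   | inj₂ v∈T   = not-¬ (∈-tabulate⁻ v∈nbrs) (nonAdjacent v∈T)

  leaf-neighbours⊆ : {w : Fin n} → w ∈ T → (⁅ u ⁆ ∪ T) ∩ neighbours G w ⊆ T - w
  leaf-neighbours⊆ {w} w∈T {v} v∈ with x∈p∩q⁻ (⁅ u ⁆ ∪ T) _ v∈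
  ... | v∈star , v∈nbrs with x∈p∪q⁻ ⁅ u ⁆ T v∈star
  ...   | inj₁ v∈⁅u⁆ = contradiction (trans (adj-sym G w u) (nonAdjacent w∈T)) (not-¬ wu)
    where
    wu : adj G w u ≡ true
    wu = subst (λ v → adj G w v ≡ true) (x∈⁅y⁆⇒x≡y u v∈⁅u⁆) (∈-tabulate⁻ v∈nbrs)
  ...   | inj₂ v∈T   = x∈p∧x≢y⇒x∈p-y v∈T λ { refl → not-¬ (∈-tabulate⁻ v∈nbrs) (adj-irrefl G w) }

  star-sparse : {k : ℕ} → ∣ T ∣ ≡ suc k → kSparse k G (⁅ u ⁆ ∪ T)
  star-sparse {k} ∣T∣≡1+k w w∈
    rewrite nbrsIn≡∣∩neighbours∣ G (⁅ u ⁆ ∪ T) w with x∈p∪q⁻ ⁅ u ⁆ T w∈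
  ... | inj₁ w∈⁅u⁆ rewrite x∈⁅y⁆⇒x≡y u w∈⁅u⁆ =
    subst (_≤ k) (sym (Empty⇒∣p∣≡0 centre-isolated)) z≤n
  ... | inj₂ w∈T   = ≤-trans (p⊆q⇒∣p∣≤∣q∣ (leaf-neighbours⊆ w∈T))
                             (≤-pred (subst (∣ T - w ∣ <_) ∣T∣≡1+k (x∈p⇒∣p-x∣<∣p∣ w∈T)))

  star-hasSparseSet : {k : ℕ} → ∣ T ∣ ≡ suc k → HasSparseSet k G (k + 2)
  star-hasSparseSet {k} ∣T∣≡1+k =
    ⁅ u ⁆ ∪ T
    , trans (x∉p⇒∣⁅x⁆∪p∣≡1+∣p∣ u∉T) (trans (cong suc ∣T∣≡1+k) (+-comm 2 k))
    , star-sparse ∣T∣≡1+k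

denseVertexSet⊎sparseStar : (k : ℕ) (G : Graph n) → HasDenseSet k G n ⊎ HasSparseSet k G (k + 2)
denseVertexSet⊎sparseStar {n} k G with all? (λ u → nonNbrsIn G ⊤ u ≤? k)
... | yes dense = inj₁ (⊤ , ∣⊤∣≡n n , λ u _ → dense u)
... | no ¬dense with ¬∀⟶∃¬ n _ (λ u → nonNbrsIn G ⊤ u ≤? k) ¬dense
...   | u , many with ⊆-withSize (suc k) (⊤ ∩ nonNeighbours G u)
                       (subst (k <_) (nonNbrsIn≡∣∩nonNeighbours∣ G ⊤ u) (≰⇒> many))
...     | T , T⊆ , ∣T∣≡1+k = inj₂ (Star.star-hasSparseSet G (p∩q⊆q ⊤ _ ∘ T⊆) ∣T∣≡1+k)

complete-∣S∣≤1+nbrsIn : {S : Subset n} {u : Fin n} → u ∈ S → ∣ S ∣ ≤ suc (nbrsIn (complete n) S u)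
complete-∣S∣≤1+nbrsIn {n} {S} {u} u∈S = begin
  ∣ S ∣                             ≤⟨ p⊆q⇒∣p∣≤∣q∣ S⊆⁅u⁆∪nbrs ⟩
  ∣ ⁅ u ⁆ ∪ S ∩ nbrs ∣               ≡⟨ x∉p⇒∣⁅x⁆∪p∣≡1+∣p∣ u∉nbrs ⟩
  suc ∣ S ∩ nbrs ∣                   ≡⟨ cong suc (nbrsIn≡∣∩neighbours∣ (complete n) S u) ⟨
  suc (nbrsIn (complete n) S u)     ∎
  where
  open ≤-Reasoning
  nbrs : Subset n
  nbrs = neighbours (complete n) u
  u∉nbrs : u ∉ S ∩ nbrs
  u∉nbrs u∈ = not-¬ (∈-tabulate⁻ (proj₂ (x∈p∩q⁻ S nbrs u∈))) (adj-irrefl (complete n) u)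
  S⊆⁅u⁆∪nbrs : S ⊆ ⁅ u ⁆ ∪ S ∩ nbrs
  S⊆⁅u⁆∪nbrs {v} v∈S with u ≟ v
  ... | yes refl = x∈p∪q⁺ (inj₁ (x∈⁅x⁆ u))
  ... | no  u≢v  = x∈p∪q⁺ (inj₂ (x∈p∩q⁺ (v∈S , ∈-neighbours-complete⁺ u≢v)))

complete-¬HasSparseSet : (k : ℕ) → ¬ HasSparseSet k (complete n) (k + 2)
complete-¬HasSparseSet k (S , ∣S∣≡k+2 , sparse) = 1+n≰n (begin
  suc (suc k)                       ≡⟨ +-comm 2 k ⟩
  k + 2                             ≡⟨ ∣S∣≡k+2 ⟨
  ∣ S ∣                             ≤⟨ complete-∣S∣≤1+nbrsIn u∈S ⟩
  suc (nbrsIn (complete _) S u)     ≤⟨ s≤s (sparse u u∈S) ⟩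
  suc k                             ∎)
  where
  open ≤-Reasoning
  nonempty : Nonempty S
  nonempty = 0<∣p∣⇒Nonempty (subst (0 <_) (trans (+-comm 2 k) (sym ∣S∣≡k+2)) (s≤s z≤n))
  u : Fin _
  u = proj₁ nonempty
  u∈S : u ∈ S
  u∈S = proj₂ nonempty

corollary5p1 : (𝒢 : GraphClass) → ContainsCompleteGraphs 𝒢 → (k i : ℕ) → k + 2 ≤ i →
    RamseyNumberIs 𝒢 k i (k + 2) i
corollary5p1 𝒢 containsComplete k i _ = (λ G _ → denseVertexSet⊎sparseStar k G) , belowFails
  where
  belowFails : ∀ m → m < i → ¬ RamseyProp 𝒢 k i (k + 2) m
  belowFails m m<i ramsey with ramsey (complete m) (containsComplete m)
  ... | inj₁ (S , ∣S∣≡i , _) = <⇒≱ m<i (subst (_≤ m) ∣S∣≡i (∣p∣≤n S))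
  ... | inj₂ sparseSet       = complete-¬HasSparseSet k sparseSet
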